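{- For any live entry $(i,j)$ of a scroll, $s(c(i,j))=c(s(i,j))$.
   Context: Let $n\ge2$ and $\mathcal{C}_n$ the cycle graph on $\mathbb{Z}_n=\{1,\dots,n\}$ with edges $\{i,i+1\}$ (mod $n$). Independent sets are binary vectors $x\in\{0,1\}^n$ with no two cyclically adjacent $1$s. The toggle $\tau_k$ changes $x_k$ from $1$ to $0$, from $0$ to $1$ if the result is independent, otherwise does nothing; $\tau=\tau_n\circ\cdots\circ\tau_1$, $x^{(i)}=\tau^i(x)$ for $i\in\mathbb{Z}$. The scroll of $x$ is the array $X_{i,j}$ ($i\in\mathbb{Z}$, $j\in\{1,\dots,n\}$) with $X_{i,j}$ the $j$-th entry of $x^{(i)}$, with convention $X_{i,j+n}=X_{i+1,j}$; live entries are positions with value $1$. The successor $s$ sends a live $(i,j)$ to the unique live element of $\{(i,j+2),(i+1,j+1)\}$, and the co-successor $c$ sends it to the unique live element of $\{(i+2,j-2),(i+2,j-1)\}$. -}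

module Defs where

open import Data.Bool using (Bool; true; false; if_then_else_; _∧_; not)
open import Data.Nat as ℕ using (ℕ; zero; suc; NonZero; _∸_)
open import Data.Nat.DivMod using (_mod_)
open import Data.Fin using (Fin; toℕ)
open import Data.List using (List; foldl; reverse)
open import Data.List using () renaming (allFin to allFinL)
open import Data.Integer as ℤ using (ℤ; +_; -[1+_]; _/ℕ_; _%ℕ_)
open import Data.Product using (_×_; _,_)
open import Relation.Binary.PropositionalEquality using (_≡_)
open import Function using (_∘_)
import Relation.Nullary

-- Cycle graph C_n on vertex set Fin n (vertex k ∈ Fin n stands for k+1 ∈ {1,…,n}).
module _ (n : ℕ) .{{_ : NonZero n}} where

  nextV : Fin n → Fin n
  nextV k = (toℕ k ℕ.+ 1) mod n

  prevV : Fin n → Fin n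
  prevV k = (toℕ k ℕ.+ (n ∸ 1)) mod n

  State : Set
  State = Fin n → Bool

  Independent : State → Set
  Independent x = ∀ (k : Fin n) → (x k ∧ x (nextV k)) ≡ false

  update : State → Fin n → Bool → State
  update x k b j with toℕ j ℕ.≟ toℕ k
  ... | Relation.Nullary.yes _ = b
  ... | Relation.Nullary.no  _ = x j

  toggle : Fin n → State → State
  toggle k x =
    if x k then update x k false
    else (if not (x (prevV k)) ∧ not (x (nextV k)) then update x k true else x)

  -- τ = τ_n ∘ ⋯ ∘ τ_1  (τ_1 applied first)
  tau : State → State
  tau x = foldl (λ y k → toggle k y) x (allFinL n)

  -- τ⁻¹ = τ_1 ∘ ⋯ ∘ τ_n  (τ_n applied first); toggles are involutions on independent sets
  tauInv : State → State
  tauInv x = foldl (λ y k → toggle k y) x (reverse (allFinL n))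

  iter : (State → State) → ℕ → State → State
  iter f zero    x = x
  iter f (suc m) x = f (iter f m x)

  tauPow : ℤ → State → State
  tauPow (+ m)      = iter tau m
  tauPow -[1+ m ]   = iter tauInv (suc m)

  -- positions of the scroll: (i , j) with i ∈ ℤ and j ∈ Fin n (column j+1 ∈ {1,…,n})
  Pos : Set
  Pos = ℤ × Fin n

  scroll : State → Pos → Bool
  scroll x (i , j) = tauPow i x j

  -- (i , j) ↦ (i + di , j + dj), normalised with the convention X_{i,j+n} = X_{i+1,j}
  shift : Pos → ℤ → ℤ → Pos
  shift (i , j) di dj =
    let t = + toℕ j ℤ.+ dj in
    (i ℤ.+ di ℤ.+ (t /ℕ n) , (t %ℕ n) mod n)

  succ : State → Pos → Pos
  succ x p = if scroll x (shift p (+ 0) (+ 2)) then shift p (+ 0) (+ 2) else shift p (+ 1) (+ 1)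

  cosucc : State → Pos → Pos
  cosucc x p = if scroll x (shift p (+ 2) (ℤ.- + 2)) then shift p (+ 2) (ℤ.- + 2) else shift p (+ 2) (ℤ.- + 1)

module Submission where

-- Read row by row, with X_{i,j+n} = X_{i+1,j}, the scroll is one 0/1 sequence indexed by ℤ
-- (position (i , j) becomes j + i n), and the shifts used by s and c become translations.
-- Since τ toggles the vertices in the order 1, …, n, vertex j sees its left neighbour already
-- updated and its right neighbour not yet updated, so every entry obeys the local rule
--   X_{i+1,j} = toggled (X_{i,j}) (X_{i+1,j-1}) (X_{i,j+1}).
-- Around a live entry this rule determines enough of the neighbouring window that s ∘ c and
-- c ∘ s agree after a case split on the two entries X_{i+2,j-2} and X_{i,j+2} choosing them.

open import Defs
open import Data.Bool using (Bool; true; false; if_then_else_; _∧_; not)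
open import Data.Bool.Properties using (∧-identityʳ; not-involutive; if-float)
open import Data.Fin as Fin using (Fin; toℕ; fromℕ<)
open import Data.Fin.Properties using (toℕ-injective; toℕ<n; toℕ-fromℕ<; fromℕ<-toℕ)
open import Data.List using ([]; _∷_; foldl; take; allFin; reverse)
open import Data.List.Properties using (foldl-∷ʳ; unfold-reverse; take-suc-tabulate; take-all; length-tabulate)
open import Function using (id; _∘_)
open import Relation.Nullary using (yes; no; contradiction)
open import Data.Integer as ℤ using (ℤ; +_; -[1+_]; _+_; _-_; -_; _*_; ∣_∣; _/ℕ_; _%ℕ_; _⊖_)
import Data.Integer.Properties as ℤ
open import Data.Integer.DivMod using (a≡a%ℕn+[a/ℕn]*n; n%ℕd<d)
open import Data.Integer.Tactic.RingSolver using (solve-∀)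
open import Data.Nat as ℕ using (ℕ; zero; suc; NonZero; _<_; _≤_)
import Data.Nat.Properties as ℕ
open import Data.Nat.DivMod using (_mod_; m<n⇒m%n≡m; n%n≡0; [m+n]%n≡m%n)
open import Data.Product using (_×_; _,_)
open import Data.Sum using (_⊎_; inj₁; inj₂)
open import Data.Empty using (⊥)
open import Relation.Binary.PropositionalEquality

toggled : Bool → Bool → Bool → Bool
toggled true  _ _ = false
toggled false l r = not l ∧ not r

toggled-involutive : ∀ a l r → l ∧ a ≡ false → a ∧ r ≡ false → toggled (toggled a l r) l r ≡ a
toggled-involutive true  false false _  _  = refl
toggled-involutive true  true  _     () _
toggled-involutive true  false true  _  ()
toggled-involutive false true  _     _  _  = refl
toggled-involutive false false true  _  _  = refl
toggled-involutive false false false _  _  = refl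

toggled-disjoint-right : ∀ a l r → toggled a l r ∧ r ≡ false
toggled-disjoint-right true  _     _     = refl
toggled-disjoint-right false true  _     = refl
toggled-disjoint-right false false true  = refl
toggled-disjoint-right false false false = refl

toggled-disjoint-left : ∀ a l r → l ∧ toggled a l r ≡ false
toggled-disjoint-left _     false _ = refl
toggled-disjoint-left true  true  _ = refl
toggled-disjoint-left false true  _ = refl

toggled-left-true : ∀ a r → toggled a true r ≡ false
toggled-left-true true  _ = refl
toggled-left-true false _ = refl

toggled-right-true : ∀ a l → toggled a l true ≡ false
toggled-right-true true  _     = refl
toggled-right-true false true  = refl
toggled-right-true false false = refl

toℕ-mod : ∀ {k n} .{{_ : NonZero n}} → k < n → toℕ (k mod n) ≡ k
toℕ-mod k<n = trans (toℕ-fromℕ< _) (m<n⇒m%n≡m k<n)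

-- ℓ r d stands for the entry r rows below and d columns right of a fixed entry of a scroll;
-- localSucc and localCosucc are s and c in these relative coordinates.
module Window (ℓ : ℤ → ℤ → Bool) where

  localSucc : ℤ × ℤ → ℤ × ℤ
  localSucc (r , d) = if ℓ r (d + + 2) then (r , d + + 2) else (r + + 1 , d + + 1)

  localCosucc : ℤ × ℤ → ℤ × ℤ
  localCosucc (r , d) = if ℓ (r + + 2) (d - + 2) then (r + + 2 , d - + 2) else (r + + 2 , d - + 1)

  module _ (rec : ∀ r d → ℓ (r + + 1) d ≡ toggled (ℓ r d) (ℓ (r + + 1) (d - + 1)) (ℓ r (d + + 1)))
           (live : ℓ (+ 0) (+ 0) ≡ true) where

    a b : Bool
    a = ℓ (+ 2) -[1+ 1 ]
    b = ℓ (+ 0) (+ 2)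

    ℓ[1,0] : ℓ (+ 1) (+ 0) ≡ false
    ℓ[1,0] rewrite rec (+ 0) (+ 0) | live = refl

    ℓ[1,-1] : ℓ (+ 1) -[1+ 0 ] ≡ false
    ℓ[1,-1] rewrite rec (+ 0) -[1+ 0 ] | live = toggled-right-true (ℓ (+ 0) -[1+ 0 ]) (ℓ (+ 1) -[1+ 1 ])

    ℓ[0,1] : ℓ (+ 0) (+ 1) ≡ false
    ℓ[0,1] rewrite rec -[1+ 0 ] (+ 1) | live = toggled-left-true (ℓ -[1+ 0 ] (+ 1)) (ℓ -[1+ 0 ] (+ 2))

    ℓ[2,-1] : ℓ (+ 2) -[1+ 0 ] ≡ not a
    ℓ[2,-1] rewrite rec (+ 1) -[1+ 0 ] | ℓ[1,-1] | ℓ[1,0] = ∧-identityʳ (not a)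

    ℓ[1,1] : ℓ (+ 1) (+ 1) ≡ not b
    ℓ[1,1] rewrite rec (+ 0) (+ 1) | ℓ[0,1] | ℓ[1,0] = refl

    ℓ[2,0] : ℓ (+ 2) (+ 0) ≡ a ∧ b
    ℓ[2,0] rewrite rec (+ 1) (+ 0) | ℓ[1,0] | ℓ[2,-1] | ℓ[1,1] | not-involutive a | not-involutive b = refl

    ℓ[2,1] : ℓ (+ 2) (+ 1) ≡ not a ∧ b
    ℓ[2,1] rewrite rec (+ 1) (+ 1) | ℓ[1,1] | ℓ[2,0] | rec (+ 0) (+ 2) with a | b
    ... | true  | true  = refl
    ... | false | true  = refl
    ... | true  | false = refl
    ... | false | false = refl

    ℓ[3,-1] : b ≡ false → ℓ (+ 3) -[1+ 0 ] ≡ a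
    ℓ[3,-1] b≡false rewrite rec (+ 2) -[1+ 0 ] | ℓ[2,-1] | ℓ[2,0] | b≡false | rec (+ 2) -[1+ 1 ] | ℓ[2,-1] with a
    ... | true  = refl
    ... | false = refl

    localSucc-localCosucc : localSucc (localCosucc (+ 0 , + 0)) ≡ localCosucc (localSucc (+ 0 , + 0))
    localSucc-localCosucc with ℓ (+ 2) -[1+ 1 ] in a≡ | ℓ (+ 0) (+ 2) in b≡
    ... | true | true rewrite ℓ[2,0] | a≡ | b≡ = refl
    ... | true  | false rewrite ℓ[2,0] | a≡ | b≡ | ℓ[3,-1] b≡ | a≡ = refl
    ... | false | true  rewrite ℓ[2,0] | ℓ[2,1] | a≡ | b≡ = refl
    ... | false | false rewrite ℓ[2,1] | ℓ[3,-1] b≡ | a≡ | b≡ = refl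

module Linear (n : ℕ) .{{_ : NonZero n}} where

  lin : Pos n → ℤ
  lin (i , j) = + toℕ j + i * + n

  lin-injective : ∀ {p q} → lin p ≡ lin q → p ≡ q
  lin-injective {i , j} {i′ , j′} eq = cong₂ _,_ i≡i′ (toℕ-injective (ℤ.+-injective j≡j′))
    where
    rows : (i - i′) * + n ≡ + toℕ j′ - + toℕ j
    rows = begin
      (i - i′) * + n                              ≡⟨ isolate (+ toℕ j) i i′ (+ n) ⟩
      (+ toℕ j + i * + n) - + toℕ j - i′ * + n    ≡⟨ cong (λ t → t - + toℕ j - i′ * + n) eq ⟩
      (+ toℕ j′ + i′ * + n) - + toℕ j - i′ * + n  ≡⟨ cancel (+ toℕ j′) (+ toℕ j) i′ (+ n) ⟩
      + toℕ j′ - + toℕ j                          ∎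
      where
      open ≡-Reasoning
      isolate : ∀ a i i′ N → (i - i′) * N ≡ (a + i * N) - a - i′ * N
      isolate = solve-∀
      cancel : ∀ a′ a i′ N → (a′ + i′ * N) - a - i′ * N ≡ a′ - a
      cancel = solve-∀
    ∣i-i′∣<1 : ∣ i - i′ ∣ < 1
    ∣i-i′∣<1 = ℕ.*-cancelʳ-< n ∣ i - i′ ∣ 1 (begin-strict
      ∣ i - i′ ∣ ℕ.* n          ≡⟨ ℤ.abs-* (i - i′) (+ n) ⟨
      ∣ (i - i′) * + n ∣        ≡⟨ cong ∣_∣ (trans rows (ℤ.m-n≡m⊖n (toℕ j′) (toℕ j))) ⟩
      ∣ toℕ j′ ⊖ toℕ j ∣        ≤⟨ ℤ.∣m⊝n∣≤m⊔n (toℕ j′) (toℕ j) ⟩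
      toℕ j′ ℕ.⊔ toℕ j          <⟨ ℕ.⊔-pres-<m (toℕ<n j′) (toℕ<n j) ⟩
      n                         ≡⟨ ℕ.*-identityˡ n ⟨
      1 ℕ.* n                   ∎)
      where open ℕ.≤-Reasoning
    i≡i′ : i ≡ i′
    i≡i′ = ℤ.i-j≡0⇒i≡j i i′ (ℤ.∣i∣≡0⇒i≡0 (ℕ.n<1⇒n≡0 ∣i-i′∣<1))
    j≡j′ : + toℕ j ≡ + toℕ j′
    j≡j′ = sym (ℤ.i-j≡0⇒i≡j _ _ (trans (sym rows) (trans (cong (λ k → (i - k) * + n) (sym i≡i′))
             (trans (cong (_* + n) (ℤ.+-inverseʳ i)) (ℤ.*-zeroˡ (+ n))))))

  lin-shift : ∀ p a b → lin (shift n p a b) ≡ lin p + (a * + n + b)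
  lin-shift (i , j) a b = begin
    + toℕ ((t %ℕ n) mod n) + (i + a + t /ℕ n) * + n  ≡⟨ cong (λ c → + c + (i + a + t /ℕ n) * + n) (toℕ-mod (n%ℕd<d t n)) ⟩
    + (t %ℕ n) + (i + a + t /ℕ n) * + n              ≡⟨ regroup (+ (t %ℕ n)) (t /ℕ n) (i + a) (+ n) ⟩
    (+ (t %ℕ n) + t /ℕ n * + n) + (i + a) * + n      ≡⟨ cong (_+ (i + a) * + n) (a≡a%ℕn+[a/ℕn]*n t n) ⟨
    t + (i + a) * + n                                ≡⟨ spread (+ toℕ j) b i a (+ n) ⟩
    lin (i , j) + (a * + n + b)                      ∎
    where
    open ≡-Reasoning
    t : ℤ
    t = + toℕ j + b
    regroup : ∀ r q s N → r + (s + q) * N ≡ (r + q * N) + s * N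
    regroup = solve-∀
    spread : ∀ c b i a N → (c + b) + (i + a) * N ≡ (c + i * N) + (a * N + b)
    spread = solve-∀

  shift-≡ : ∀ p {q} a b → lin q ≡ lin p + (a * + n + b) → shift n p a b ≡ q
  shift-≡ p a b eq = lin-injective (trans (lin-shift p a b) (sym eq))

  shift-zero : ∀ p → shift n p (+ 0) (+ 0) ≡ p
  shift-zero p = shift-≡ p (+ 0) (+ 0) (sym (ℤ.+-identityʳ (lin p)))

  shift-shift : ∀ p a b c d → shift n (shift n p a b) c d ≡ shift n p (a + c) (b + d)
  shift-shift p a b c d = shift-≡ (shift n p a b) c d (begin
    lin (shift n p (a + c) (b + d))                ≡⟨ lin-shift p (a + c) (b + d) ⟩
    lin p + ((a + c) * + n + (b + d))              ≡⟨ merge (lin p) a b c d (+ n) ⟨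
    (lin p + (a * + n + b)) + (c * + n + d)        ≡⟨ cong (_+ (c * + n + d)) (lin-shift p a b) ⟨
    lin (shift n p a b) + (c * + n + d)            ∎)
    where
    open ≡-Reasoning
    merge : ∀ l a b c d N → (l + (a * N + b)) + (c * N + d) ≡ l + ((a + c) * N + (b + d))
    merge = solve-∀

  shift-vertical : ∀ i j r → shift n (i , j) r (+ 0) ≡ (i + r , j)
  shift-vertical i j r = shift-≡ (i , j) r (+ 0) (vertical (+ toℕ j) i r (+ n))
    where
    vertical : ∀ c i r N → c + (i + r) * N ≡ (c + i * N) + (r * N + + 0)
    vertical = solve-∀

module Toggling (n : ℕ) .{{_ : NonZero n}} where

  update-same : ∀ (w : State n) k b → update n w k b k ≡ b
  update-same w k b with toℕ k ℕ.≟ toℕ k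
  ... | yes _   = refl
  ... | no  k≢k = contradiction refl k≢k

  update-other : ∀ (w : State n) {j k} b → j ≢ k → update n w k b j ≡ w j
  update-other w {j} {k} b j≢k with toℕ j ℕ.≟ toℕ k
  ... | yes eq = contradiction (toℕ-injective eq) j≢k
  ... | no  _  = refl

  toggle-self : ∀ k (w : State n) → toggle n k w k ≡ toggled (w k) (w (prevV n k)) (w (nextV n k))
  toggle-self k w with w k in wk
  ... | true = update-same w k false
  ... | false with not (w (prevV n k)) ∧ not (w (nextV n k))
  ...   | true  = update-same w k true
  ...   | false = wk

  toggle-other : ∀ {j k} (w : State n) → j ≢ k → toggle n k w j ≡ w j
  toggle-other {k = k} w j≢k with w k
  ... | true = update-other w false j≢k
  ... | false with not (w (prevV n k)) ∧ not (w (nextV n k))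
  ...   | true  = update-other w true j≢k
  ...   | false = refl

  toggle-cong : ∀ k {w w′ : State n} → w ≗ w′ → toggle n k w ≗ toggle n k w′
  toggle-cong k {w} {w′} w≗w′ j with j Fin.≟ k
  ... | yes refl rewrite toggle-self j w | toggle-self j w′ | w≗w′ j | w≗w′ (prevV n j) | w≗w′ (nextV n j) = refl
  ... | no  j≢k  = trans (toggle-other w j≢k) (trans (w≗w′ j) (sym (toggle-other w′ j≢k)))

  step : State n → Fin n → State n
  step w k = toggle n k w

  toggles-cong : ∀ ks {w w′ : State n} → w ≗ w′ → foldl step w ks ≗ foldl step w′ ks
  toggles-cong []       w≗w′ = w≗w′
  toggles-cong (k ∷ ks) w≗w′ = toggles-cong ks (toggle-cong k w≗w′)

  sweep : State n → ℕ → State n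
  sweep y k = foldl step y (take k (allFin n))

  module _ (y : State n) where

    sweep-all : sweep y n ≡ tau n y
    sweep-all = cong (foldl step y) (take-all n (allFin n) (ℕ.≤-reflexive (length-tabulate id)))

    sweep-suc : ∀ {k} (k<n : k < n) → sweep y (suc k) ≡ toggle n (fromℕ< k<n) (sweep y k)
    sweep-suc k<n = subst (λ t → sweep y (suc t) ≡ toggle n i (sweep y t)) (toℕ-fromℕ< k<n)
      (trans (cong (foldl step y) (take-suc-tabulate id i)) (foldl-∷ʳ step y i (take (toℕ i) (allFin n))))
      where
      i : Fin n
      i = fromℕ< k<n

    sweep-suc-other : ∀ {k} (k<n : k < n) v → toℕ v ≢ k → sweep y (suc k) v ≡ sweep y k v
    sweep-suc-other {k} k<n v v≢k = trans (cong (λ w → w v) (sweep-suc k<n))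
      (toggle-other (sweep y k) (λ eq → v≢k (trans (cong toℕ eq) (toℕ-fromℕ< k<n))))

    sweep-pending : ∀ k v → k ≤ toℕ v → sweep y k v ≡ y v
    sweep-pending zero    v _   = refl
    sweep-pending (suc k) v k<v = trans (sweep-suc-other (ℕ.<-trans k<v (toℕ<n v)) v (ℕ.>⇒≢ k<v))
      (sweep-pending k v (ℕ.<⇒≤ k<v))

    sweep-stable : ∀ {k} k′ v → toℕ v < k → k ≤ k′ → k′ ≤ n → sweep y k v ≡ sweep y k′ v
    sweep-stable zero     v () ℕ.z≤n _
    sweep-stable (suc k′) v v<k k≤1+k′ 1+k′≤n with ℕ.m≤n⇒m<n∨m≡n k≤1+k′
    ... | inj₂ refl        = refl
    ... | inj₁ (ℕ.s≤s k≤k′) = trans (sweep-stable k′ v v<k k≤k′ (ℕ.<⇒≤ 1+k′≤n))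
      (sym (sweep-suc-other 1+k′≤n v (ℕ.<⇒≢ (ℕ.<-≤-trans v<k k≤k′))))

    sweep-done : ∀ {k} v → toℕ v < k → k ≤ n → sweep y k v ≡ tau n y v
    sweep-done v v<k k≤n = trans (sweep-stable n v v<k k≤n ℕ.≤-refl) (cong (λ w → w v) sweep-all)

    tau-at : ∀ j → tau n y j ≡ toggled (y j) (sweep y (toℕ j) (prevV n j)) (sweep y (toℕ j) (nextV n j))
    tau-at j = begin
      tau n y j                                         ≡⟨ sweep-done j (ℕ.n<1+n (toℕ j)) (toℕ<n j) ⟨
      sweep y (suc (toℕ j)) j                           ≡⟨ cong (λ w → w j) (sweep-suc (toℕ<n j)) ⟩
      toggle n (fromℕ< (toℕ<n j)) (sweep y (toℕ j)) j  ≡⟨ cong (λ k → toggle n k (sweep y (toℕ j)) j) (fromℕ<-toℕ j (toℕ<n j)) ⟩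
      toggle n j (sweep y (toℕ j)) j                    ≡⟨ toggle-self j (sweep y (toℕ j)) ⟩
      toggled (sweep y (toℕ j) j) l r                   ≡⟨ cong (λ a → toggled a l r) (sweep-pending (toℕ j) j ℕ.≤-refl) ⟩
      toggled (y j) l r                                 ∎
      where
      open ≡-Reasoning
      l r : Bool
      l = sweep y (toℕ j) (prevV n j)
      r = sweep y (toℕ j) (nextV n j)

module Cycle (m : ℕ) where

  n : ℕ
  n = suc (suc m)

  open Linear n
  open Toggling n

  next-inner : ∀ j → suc (toℕ j) < n → toℕ (nextV n j) ≡ suc (toℕ j)
  next-inner j j+1<n = trans (cong (λ k → toℕ (k mod n)) (ℕ.+-comm (toℕ j) 1)) (toℕ-mod j+1<n)

  next-last : ∀ j → suc (toℕ j) ≡ n → toℕ (nextV n j) ≡ 0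
  next-last j j+1≡n = begin
    toℕ ((toℕ j ℕ.+ 1) mod n) ≡⟨ toℕ-fromℕ< _ ⟩
    (toℕ j ℕ.+ 1) ℕ.% n       ≡⟨ cong (ℕ._% n) (trans (ℕ.+-comm (toℕ j) 1) j+1≡n) ⟩
    n ℕ.% n                   ≡⟨ n%n≡0 n ⟩
    0                         ∎
    where open ≡-Reasoning

  prev-inner : ∀ j {t} → toℕ j ≡ suc t → toℕ (prevV n j) ≡ t
  prev-inner j {t} j≡1+t = begin
    toℕ ((toℕ j ℕ.+ suc m) mod n) ≡⟨ toℕ-fromℕ< _ ⟩
    (toℕ j ℕ.+ suc m) ℕ.% n       ≡⟨ cong (λ k → (k ℕ.+ suc m) ℕ.% n) j≡1+t ⟩
    (suc t ℕ.+ suc m) ℕ.% n       ≡⟨ cong (ℕ._% n) (ℕ.+-suc t (suc m)) ⟨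
    (t ℕ.+ n) ℕ.% n               ≡⟨ [m+n]%n≡m%n t n ⟩
    t ℕ.% n                       ≡⟨ m<n⇒m%n≡m t<n ⟩
    t                             ∎
    where
    open ≡-Reasoning
    t<n : t < n
    t<n = ℕ.<-trans (ℕ.n<1+n t) (subst (_< n) j≡1+t (toℕ<n j))

  prev-first : ∀ j → toℕ j ≡ 0 → toℕ (prevV n j) ≡ suc m
  prev-first j j≡0 = trans (cong (λ k → toℕ ((k ℕ.+ suc m) mod n)) j≡0) (toℕ-mod ℕ.≤-refl)

  next≢ : ∀ j → nextV n j ≢ j
  next≢ j eq with ℕ.m≤n⇒m<n∨m≡n (toℕ<n j)
  ... | inj₁ inner = ℕ.1+n≢n (trans (sym (next-inner j inner)) (cong toℕ eq))
  ... | inj₂ last  = ℕ.0≢1+n (trans (sym (next-last j last)) (trans (cong toℕ eq) (ℕ.suc-injective last)))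

  prev≢ : ∀ j → prevV n j ≢ j
  prev≢ j eq = case (toℕ j) refl
    where
    case : ∀ k → toℕ j ≡ k → ⊥
    case zero    j≡0   = ℕ.1+n≢0 (trans (sym (prev-first j j≡0)) (trans (cong toℕ eq) j≡0))
    case (suc t) j≡1+t = ℕ.1+n≢n (sym (trans (sym (prev-inner j j≡1+t)) (trans (cong toℕ eq) j≡1+t)))

  prev-next : ∀ j → prevV n (nextV n j) ≡ j
  prev-next j = toℕ-injective (case (ℕ.m≤n⇒m<n∨m≡n (toℕ<n j)))
    where
    case : suc (toℕ j) < n ⊎ suc (toℕ j) ≡ n → toℕ (prevV n (nextV n j)) ≡ toℕ j
    case (inj₁ inner) = prev-inner (nextV n j) (next-inner j inner)
    case (inj₂ last)  = trans (prev-first (nextV n j) (next-last j last)) (sym (ℕ.suc-injective last))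

  next-prev : ∀ j → nextV n (prevV n j) ≡ j
  next-prev j = toℕ-injective (case (toℕ j) refl)
    where
    case : ∀ k → toℕ j ≡ k → toℕ (nextV n (prevV n j)) ≡ toℕ j
    case zero    j≡0   = trans (next-last (prevV n j) (cong suc (prev-first j j≡0))) (sym j≡0)
    case (suc t) j≡1+t = trans (next-inner (prevV n j) inner) (trans (cong suc (prev-inner j j≡1+t)) (sym j≡1+t))
      where
      inner : suc (toℕ (prevV n j)) < n
      inner = subst (λ k → suc k < n) (sym (prev-inner j j≡1+t)) (subst (_< n) j≡1+t (toℕ<n j))

  toggle-involutive : ∀ k (w : State n) → Independent n w → toggle n k (toggle n k w) ≗ w
  toggle-involutive k w ind j with j Fin.≟ k
  ... | no j≢k  = trans (toggle-other (toggle n k w) j≢k) (toggle-other w j≢k)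
  ... | yes refl = begin
    toggle n j (toggle n j w) j                                 ≡⟨ toggle-self j (toggle n j w) ⟩
    toggled (toggle n j w j) (toggle n j w l) (toggle n j w r)  ≡⟨ cong₂ (toggled (toggle n j w j))
                                                                     (toggle-other w (prev≢ j)) (toggle-other w (next≢ j)) ⟩
    toggled (toggle n j w j) (w l) (w r)                        ≡⟨ cong (λ a → toggled a (w l) (w r)) (toggle-self j w) ⟩
    toggled (toggled (w j) (w l) (w r)) (w l) (w r)             ≡⟨ toggled-involutive (w j) (w l) (w r)
                                                                     (subst (λ k → w l ∧ w k ≡ false) (next-prev j) (ind l)) (ind j) ⟩
    w j                                                         ∎
    where
    open ≡-Reasoning
    l r : Fin n
    l = prevV n j
    r = nextV n j

  toggle-independent : ∀ k (w : State n) → Independent n w → Independent n (toggle n k w)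
  toggle-independent k w ind j with j Fin.≟ k | nextV n j Fin.≟ k
  ... | yes refl | _ = trans (cong₂ _∧_ (toggle-self j w) (toggle-other w (next≢ j)))
                             (toggled-disjoint-right (w j) (w (prevV n j)) (w (nextV n j)))
  ... | no j≢k | yes refl = begin
    toggle n r w j ∧ toggle n r w r                       ≡⟨ cong₂ _∧_ (toggle-other w j≢k) (toggle-self r w) ⟩
    w j ∧ toggled (w r) (w (prevV n r)) (w (nextV n r))   ≡⟨ cong (λ l → w j ∧ toggled (w r) (w l) (w (nextV n r))) (prev-next j) ⟩
    w j ∧ toggled (w r) (w j) (w (nextV n r))             ≡⟨ toggled-disjoint-left (w r) (w j) (w (nextV n r)) ⟩
    false                                                 ∎
    where
    open ≡-Reasoning
    r : Fin n
    r = nextV n j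
  ... | no j≢k | no j+1≢k = trans (cong₂ _∧_ (toggle-other w j≢k) (toggle-other w j+1≢k)) (ind j)

  toggles-independent : ∀ ks (w : State n) → Independent n w → Independent n (foldl step w ks)
  toggles-independent []       w ind = ind
  toggles-independent (k ∷ ks) w ind = toggles-independent ks (step w k) (toggle-independent k w ind)

  toggles-reverse : ∀ ks (w : State n) → Independent n w → foldl step (foldl step w (reverse ks)) ks ≗ w
  toggles-reverse []       w ind j = refl
  toggles-reverse (k ∷ ks) w ind j = begin
    foldl step (foldl step w (reverse (k ∷ ks))) (k ∷ ks) j ≡⟨ cong (λ u → foldl step (step u k) ks j) unfold ⟩
    foldl step (step (step u k) k) ks j                      ≡⟨ toggles-cong ks (toggle-involutive k u (toggles-independent (reverse ks) w ind)) j ⟩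
    foldl step u ks j                                        ≡⟨ toggles-reverse ks w ind j ⟩
    w j                                                      ∎
    where
    open ≡-Reasoning
    u : State n
    u = foldl step w (reverse ks)
    unfold : foldl step w (reverse (k ∷ ks)) ≡ step u k
    unfold = trans (cong (foldl step w) (unfold-reverse k ks)) (foldl-∷ʳ step w k (reverse ks))

  tauInv-iterate-independent : ∀ k (x : State n) → Independent n x → Independent n (iter n (tauInv n) k x)
  tauInv-iterate-independent zero    x ind = ind
  tauInv-iterate-independent (suc k) x ind =
    toggles-independent (reverse (allFin n)) (iter n (tauInv n) k x) (tauInv-iterate-independent k x ind)

  tau-tauInv : ∀ (w : State n) → Independent n w → tau n (tauInv n w) ≗ w
  tau-tauInv = toggles-reverse (allFin n)

  tauPow-suc : ∀ i (x : State n) → Independent n x → tauPow n (i + + 1) x ≗ tau n (tauPow n i x)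
  tauPow-suc (+ k)          x _   j = cong (λ t → iter n (tau n) t x j) (ℕ.+-comm k 1)
  tauPow-suc -[1+ zero ]    x ind j = sym (tau-tauInv x ind j)
  tauPow-suc -[1+ suc k ]   x ind j = sym (tau-tauInv _ (tauInv-iterate-independent (suc k) x ind) j)

  shift-prev-first : ∀ i j → toℕ j ≡ 0 → shift n (i , j) (+ 1) -[1+ 0 ] ≡ (i , prevV n j)
  shift-prev-first i j j≡0 = shift-≡ (i , j) (+ 1) -[1+ 0 ] (begin
    + toℕ (prevV n j) + i * + n                    ≡⟨ cong (λ c → + c + i * + n) (prev-first j j≡0) ⟩
    + suc m + i * + n                              ≡⟨ wrap (+ suc m) i ⟩
    (+ 0 + i * + n) + (+ 1 * + n + -[1+ 0 ])       ≡⟨ cong (λ c → (+ c + i * + n) + (+ 1 * + n + -[1+ 0 ])) j≡0 ⟨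
    lin (i , j) + (+ 1 * + n + -[1+ 0 ])           ∎)
    where
    open ≡-Reasoning
    wrap : ∀ s i → s + i * (+ 1 + s) ≡ (+ 0 + i * (+ 1 + s)) + (+ 1 * (+ 1 + s) + -[1+ 0 ])
    wrap = solve-∀

  shift-prev-inner : ∀ i j {t} → toℕ j ≡ suc t → shift n (i , j) (+ 1) -[1+ 0 ] ≡ (i + + 1 , prevV n j)
  shift-prev-inner i j {t} j≡1+t = shift-≡ (i , j) (+ 1) -[1+ 0 ] (begin
    + toℕ (prevV n j) + (i + + 1) * + n            ≡⟨ cong (λ c → + c + (i + + 1) * + n) (prev-inner j j≡1+t) ⟩
    + t + (i + + 1) * + n                          ≡⟨ inner (+ t) i (+ n) ⟩
    (+ suc t + i * + n) + (+ 1 * + n + -[1+ 0 ])   ≡⟨ cong (λ c → (+ c + i * + n) + (+ 1 * + n + -[1+ 0 ])) j≡1+t ⟨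
    lin (i , j) + (+ 1 * + n + -[1+ 0 ])           ∎)
    where
    open ≡-Reasoning
    inner : ∀ t i N → t + (i + + 1) * N ≡ ((+ 1 + t) + i * N) + (+ 1 * N + -[1+ 0 ])
    inner = solve-∀

  shift-next-inner : ∀ i j → suc (toℕ j) < n → shift n (i , j) (+ 0) (+ 1) ≡ (i , nextV n j)
  shift-next-inner i j j+1<n = shift-≡ (i , j) (+ 0) (+ 1) (begin
    + toℕ (nextV n j) + i * + n                    ≡⟨ cong (λ c → + c + i * + n) (next-inner j j+1<n) ⟩
    + suc (toℕ j) + i * + n                        ≡⟨ inner (+ toℕ j) i (+ n) ⟩
    lin (i , j) + (+ 0 * + n + + 1)                ∎)
    where
    open ≡-Reasoning
    inner : ∀ c i N → (+ 1 + c) + i * N ≡ (c + i * N) + (+ 0 * N + + 1)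
    inner = solve-∀

  shift-next-last : ∀ i j → suc (toℕ j) ≡ n → shift n (i , j) (+ 0) (+ 1) ≡ (i + + 1 , nextV n j)
  shift-next-last i j j+1≡n = shift-≡ (i , j) (+ 0) (+ 1) (begin
    + toℕ (nextV n j) + (i + + 1) * + n            ≡⟨ cong (λ c → + c + (i + + 1) * + n) (next-last j j+1≡n) ⟩
    + 0 + (i + + 1) * + n                          ≡⟨ wrap (+ suc m) i ⟩
    (+ suc m + i * + n) + (+ 0 * + n + + 1)        ≡⟨ cong (λ c → (+ c + i * + n) + (+ 0 * + n + + 1)) (ℕ.suc-injective j+1≡n) ⟨
    lin (i , j) + (+ 0 * + n + + 1)                ∎)
    where
    open ≡-Reasoning
    wrap : ∀ s i → + 0 + (i + + 1) * (+ 1 + s) ≡ (s + i * (+ 1 + s)) + (+ 0 * (+ 1 + s) + + 1)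
    wrap = solve-∀

  module Scroll (x : State n) (ind : Independent n x) where

    sweep-prev : ∀ i j → sweep (tauPow n i x) (toℕ j) (prevV n j) ≡ scroll n x (shift n (i , j) (+ 1) -[1+ 0 ])
    sweep-prev i j = case (toℕ j) refl
      where
      open ≡-Reasoning
      y : State n
      y = tauPow n i x
      case : ∀ k → toℕ j ≡ k → sweep y (toℕ j) (prevV n j) ≡ scroll n x (shift n (i , j) (+ 1) -[1+ 0 ])
      case zero j≡0 = begin
        sweep y (toℕ j) (prevV n j)                    ≡⟨ sweep-pending y (toℕ j) (prevV n j) j≤prev ⟩
        scroll n x (i , prevV n j)                     ≡⟨ cong (scroll n x) (shift-prev-first i j j≡0) ⟨
        scroll n x (shift n (i , j) (+ 1) -[1+ 0 ])    ∎
        where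
        j≤prev : toℕ j ≤ toℕ (prevV n j)
        j≤prev = subst (_≤ toℕ (prevV n j)) (sym j≡0) ℕ.z≤n
      case (suc t) j≡1+t = begin
        sweep y (toℕ j) (prevV n j)                    ≡⟨ sweep-done y (prevV n j) prev<j (ℕ.<⇒≤ (toℕ<n j)) ⟩
        tau n y (prevV n j)                            ≡⟨ tauPow-suc i x ind (prevV n j) ⟨
        scroll n x (i + + 1 , prevV n j)               ≡⟨ cong (scroll n x) (shift-prev-inner i j j≡1+t) ⟨
        scroll n x (shift n (i , j) (+ 1) -[1+ 0 ])    ∎
        where
        prev<j : toℕ (prevV n j) < toℕ j
        prev<j = subst₂ _<_ (sym (prev-inner j j≡1+t)) (sym j≡1+t) (ℕ.n<1+n t)

    sweep-next : ∀ i j → sweep (tauPow n i x) (toℕ j) (nextV n j) ≡ scroll n x (shift n (i , j) (+ 0) (+ 1))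
    sweep-next i j = case (ℕ.m≤n⇒m<n∨m≡n (toℕ<n j))
      where
      open ≡-Reasoning
      y : State n
      y = tauPow n i x
      case : suc (toℕ j) < n ⊎ suc (toℕ j) ≡ n → sweep y (toℕ j) (nextV n j) ≡ scroll n x (shift n (i , j) (+ 0) (+ 1))
      case (inj₁ j+1<n) = begin
        sweep y (toℕ j) (nextV n j)                    ≡⟨ sweep-pending y (toℕ j) (nextV n j) j≤next ⟩
        scroll n x (i , nextV n j)                     ≡⟨ cong (scroll n x) (shift-next-inner i j j+1<n) ⟨
        scroll n x (shift n (i , j) (+ 0) (+ 1))       ∎
        where
        j≤next : toℕ j ≤ toℕ (nextV n j)
        j≤next = subst (toℕ j ≤_) (sym (next-inner j j+1<n)) (ℕ.n≤1+n (toℕ j))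
      case (inj₂ j+1≡n) = begin
        sweep y (toℕ j) (nextV n j)                    ≡⟨ sweep-done y (nextV n j) next<j (ℕ.<⇒≤ (toℕ<n j)) ⟩
        tau n y (nextV n j)                            ≡⟨ tauPow-suc i x ind (nextV n j) ⟨
        scroll n x (i + + 1 , nextV n j)               ≡⟨ cong (scroll n x) (shift-next-last i j j+1≡n) ⟨
        scroll n x (shift n (i , j) (+ 0) (+ 1))       ∎
        where
        next<j : toℕ (nextV n j) < toℕ j
        next<j = subst₂ _<_ (sym (next-last j j+1≡n)) (sym (ℕ.suc-injective j+1≡n)) (ℕ.z<s {m})

    scroll-rec : ∀ q → scroll n x (shift n q (+ 1) (+ 0))
                       ≡ toggled (scroll n x q) (scroll n x (shift n q (+ 1) -[1+ 0 ])) (scroll n x (shift n q (+ 0) (+ 1)))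
    scroll-rec (i , j) = begin
      scroll n x (shift n (i , j) (+ 1) (+ 0))  ≡⟨ cong (scroll n x) (shift-vertical i j (+ 1)) ⟩
      tauPow n (i + + 1) x j                    ≡⟨ tauPow-suc i x ind j ⟩
      tau n y j                                 ≡⟨ tau-at y j ⟩
      toggled (y j) (sweep y (toℕ j) (prevV n j)) (sweep y (toℕ j) (nextV n j))
                                                ≡⟨ cong₂ (toggled (y j)) (sweep-prev i j) (sweep-next i j) ⟩
      toggled (y j) (scroll n x (shift n (i , j) (+ 1) -[1+ 0 ])) (scroll n x (shift n (i , j) (+ 0) (+ 1))) ∎
      where
      open ≡-Reasoning
      y : State n
      y = tauPow n i x

    module Around (p : Pos n) where

      grid : ℤ → ℤ → Bool
      grid r d = scroll n x (shift n p r d)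

      at : ℤ × ℤ → Pos n
      at (r , d) = shift n p r d

      open Window grid

      grid-rec : ∀ r d → grid (r + + 1) d ≡ toggled (grid r d) (grid (r + + 1) (d - + 1)) (grid r (d + + 1))
      grid-rec r d = begin
        grid (r + + 1) d                                  ≡⟨ cong (grid (r + + 1)) (ℤ.+-identityʳ d) ⟨
        scroll n x (shift n p (r + + 1) (d + + 0))        ≡⟨ cong (scroll n x) (shift-shift p r d (+ 1) (+ 0)) ⟨
        scroll n x (shift n q (+ 1) (+ 0))                ≡⟨ scroll-rec q ⟩
        toggled (grid r d) (scroll n x (shift n q (+ 1) -[1+ 0 ])) (scroll n x (shift n q (+ 0) (+ 1)))
                                                          ≡⟨ cong₂ (toggled (grid r d)) (cong (scroll n x) (shift-shift p r d (+ 1) -[1+ 0 ]))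
                                                               (cong (scroll n x) (shift-shift p r d (+ 0) (+ 1))) ⟩
        toggled (grid r d) (grid (r + + 1) (d - + 1)) (grid (r + + 0) (d + + 1))
                                                          ≡⟨ cong (λ r′ → toggled (grid r d) (grid (r + + 1) (d - + 1)) (grid r′ (d + + 1))) (ℤ.+-identityʳ r) ⟩
        toggled (grid r d) (grid (r + + 1) (d - + 1)) (grid r (d + + 1)) ∎
        where
        open ≡-Reasoning
        q : Pos n
        q = shift n p r d

      choose : Pos n → Pos n → Pos n
      choose u v = if scroll n x u then u else v

      succ-at : ∀ o → succ n x (at o) ≡ at (localSucc o)
      succ-at (r , d) = begin
        succ n x (shift n p r d)                                               ≡⟨ cong₂ choose (shift-shift p r d (+ 0) (+ 2))
                                                                                    (shift-shift p r d (+ 1) (+ 1)) ⟩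
        choose (shift n p (r + + 0) (d + + 2)) (shift n p (r + + 1) (d + + 1)) ≡⟨ cong (λ r′ → choose (shift n p r′ (d + + 2)) (shift n p (r + + 1) (d + + 1)))
                                                                                    (ℤ.+-identityʳ r) ⟩
        choose (at (r , d + + 2)) (at (r + + 1 , d + + 1))                     ≡⟨ if-float at (grid r (d + + 2)) ⟨
        at (localSucc (r , d))                                                 ∎
        where open ≡-Reasoning

      cosucc-at : ∀ o → cosucc n x (at o) ≡ at (localCosucc o)
      cosucc-at (r , d) = begin
        cosucc n x (shift n p r d)                               ≡⟨ cong₂ choose (shift-shift p r d (+ 2) (- + 2))
                                                                      (shift-shift p r d (+ 2) (- + 1)) ⟩
        choose (at (r + + 2 , d - + 2)) (at (r + + 2 , d - + 1)) ≡⟨ if-float at (grid (r + + 2) (d - + 2)) ⟨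
        at (localCosucc (r , d))                                 ∎
        where open ≡-Reasoning

proposition2p5 : (n : ℕ) → .{{_ : NonZero n}} → 2 ≤ n →
    (x : State n) → Independent n x →
    (p : Pos n) → scroll n x p ≡ true →
    succ n x (cosucc n x p) ≡ cosucc n x (succ n x p)
proposition2p5 (suc (suc m)) (ℕ.s≤s (ℕ.s≤s _)) x ind p live = begin
  succ n x (cosucc n x p)                  ≡⟨ cong (succ n x ∘ cosucc n x) (shift-zero p) ⟨
  succ n x (cosucc n x (at origin))        ≡⟨ cong (succ n x) (cosucc-at origin) ⟩
  succ n x (at (localCosucc origin))       ≡⟨ succ-at (localCosucc origin) ⟩
  at (localSucc (localCosucc origin))      ≡⟨ cong at (localSucc-localCosucc grid-rec (trans (cong (scroll n x) (shift-zero p)) live)) ⟩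
  at (localCosucc (localSucc origin))      ≡⟨ cosucc-at (localSucc origin) ⟨
  cosucc n x (at (localSucc origin))       ≡⟨ cong (cosucc n x) (succ-at origin) ⟨
  cosucc n x (succ n x (at origin))        ≡⟨ cong (cosucc n x ∘ succ n x) (shift-zero p) ⟩
  cosucc n x (succ n x p)                  ∎
  where
  open ≡-Reasoning
  open Cycle m
  open Linear n
  open Scroll x ind
  open Around p
  open Window grid
  origin : ℤ × ℤ
  origin = + 0 , + 0
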